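{- Let $2\le l\le n$ and let $\alpha$ be a cascading $n$-sequence which is an $l$-plateau. Then for every $i$ and every $j<l$, the initial segment $\alpha[i]$ contains at least as many lower subintervals with head $l$ as lower subintervals with head $j$.
   Context: An $m$-lower subinterval ($1\le a\le m\le n$) is the tuple $(a,a+1,\ldots,m)$; its head is $a$ and its right endpoint is $m$. An $m$-component is a finite (possibly empty) sequence of $m$-lower subintervals ordered by nonincreasing length; a cascading $n$-sequence is the concatenation of an $n$-component, an $(n-1)$-component, $\ldots$, a $1$-component, regarded both as its list of lower subintervals $I_1,\ldots,I_P$ (left to right) and as the concatenated integer sequence. For $i\le P$, $\alpha[i]$ denotes the cascading sequence consisting of $I_1,\ldots,I_i$. Lanes: the entries of $\alpha$ are distributed into lanes $L_d(v)$ ($v\in[n]$, $d\ge1$), tuples of entries of value $v$, by processing $I_1,\ldots,I_P$ in order, all lanes initially empty; to process $I_b=(v_1,\ldots,v_s)$: let $d_1$ be the largest $d\ge1$ with $L_d(v_1)$ currently nonempty ($0$ if none) and append the entry $v_1$ of $I_b$ to $L_{d_1+1}(v_1)$; for $k=2,\ldots,s$ in order let $d_k$ be the largest $d$ with $1\le d\le d_{k-1}$ and $|L_d(v_k)|>|L_{d+1}(v_k)|$ (current lengths, $|L|$ the number of entries), or $0$ if none, and append the entry $v_k$ of $I_b$ to $L_{d_k+1}(v_k)$. A nonempty lane $L_d(v)$ is a $v$-lane; it ends at a right endpoint if its last entry is the right endpoint of the lower subinterval containing it. For $2\le m\le n$, $\alpha$ is an $m$-plateau if: (i) for every $i$ with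 $L_i(m)$ nonempty, $|L_i(m-1)|=|L_i(m)|-1$; (ii) no $(m-1)$-lane ends at a right endpoint; (iii) for every $k<m-1$, no $k$-lane ends at a right endpoint. -}

module Defs where

open import Data.Nat using (ℕ; zero; suc; _+_; _∸_; _≤_; _<_; _≟_; _<ᵇ_; _≡ᵇ_)
open import Data.Nat.Properties using ()
open import Data.Bool using (Bool; true; false; if_then_else_)
open import Data.List using (List; []; _∷_; _++_; [_]; length; foldl; filter; take; last; replicate)
open import Data.List.Relation.Unary.All using (All)
open import Data.List.Relation.Unary.Linked using (Linked)
open import Data.Product using (_×_; _,_; proj₁; proj₂)
open import Data.Sum using (_⊎_)
open import Data.Maybe using (Maybe; just)
open import Relation.Binary.PropositionalEquality using (_≡_)
open import Relation.Nullary using (¬_)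

-- A lower subinterval (a, a+1, ..., m) is represented by the pair
-- (a , m) : its head a and its right endpoint m.
LowerSub : Set
LowerSub = ℕ × ℕ

head : LowerSub → ℕ
head = proj₁

rightEnd : LowerSub → ℕ
rightEnd = proj₂

ValidSub : ℕ → LowerSub → Set
ValidSub n (a , m) = 1 ≤ a × a ≤ m × m ≤ n

-- Order between consecutive subintervals of a cascading sequence:
-- either the next one lies in a later (smaller-m) component, or it lies in
-- the same m-component and is not longer (head not smaller).
CascStep : LowerSub → LowerSub → Set
CascStep (a , m) (a' , m') = m' < m ⊎ (m' ≡ m × a ≤ a')

IsCascading : ℕ → List LowerSub → Set
IsCascading n α = All (ValidSub n) α × Linked CascStep α

prefix : ℕ → List LowerSub → List LowerSub
prefix i α = take i α

countHead : ℕ → List LowerSub → ℕ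
countHead h α = length (filter (λ I → head I ≟ h) α)

-- An entry of a lane is recorded by whether it is the right endpoint of
-- the lower subinterval containing it.
Lane : Set
Lane = List Bool

-- Lanes v = [ L_1(v) , L_2(v) , ... ]; lanes beyond the list are empty.
Lanes : Set
Lanes = ℕ → List Lane

emptyLanes : Lanes
emptyLanes _ = []

nth : List Lane → ℕ → Lane
nth [] _ = []
nth (x ∷ xs) zero = x
nth (x ∷ xs) (suc p) = nth xs p

-- L_d(v) for d ≥ 1 (L_0 is taken to be empty; never used)
lane : Lanes → ℕ → ℕ → Lane
lane L v zero = []
lane L v (suc p) = nth (L v) p

appendAt : List Lane → ℕ → Bool → List Lane
appendAt [] zero b = [ b ] ∷ []
appendAt [] (suc p) b = [] ∷ appendAt [] p b
appendAt (x ∷ xs) zero b = (x ++ [ b ]) ∷ xs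
appendAt (x ∷ xs) (suc p) b = x ∷ appendAt xs p b

appendLane : Lanes → ℕ → ℕ → Bool → Lanes
appendLane L v d b w with w ≟ v | d
... | Relation.Nullary.yes _ | suc p = appendAt (L w) p b
... | Relation.Nullary.yes _ | zero  = L w
... | Relation.Nullary.no _  | _     = L w

isNonempty : Lane → Bool
isNonempty [] = false
isNonempty (_ ∷ _) = true

-- largest d ≥ 1 with L_d nonempty, 0 if none (lanes given as a list,
-- the first element being L_1)
largestNonemptyFrom : ℕ → List Lane → ℕ → ℕ
largestNonemptyFrom best [] _ = best
largestNonemptyFrom best (x ∷ xs) d =
  largestNonemptyFrom (if isNonempty x then d else best) xs (suc d)

largestNonempty : List Lane → ℕ
largestNonempty ls = largestNonemptyFrom 0 ls 1

searchDown : (ℕ → Bool) → ℕ → ℕ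
searchDown p zero = zero
searchDown p (suc d) = if p (suc d) then suc d else searchDown p d

-- process the entries v, v+1, ..., v+r of a subinterval with right
-- endpoint m, dprev being d_{k-1}
processRest : Lanes → ℕ → ℕ → ℕ → ℕ → Lanes
processRest L v zero dprev m = L
processRest L v (suc r) dprev m =
  let dk = searchDown (λ d → length (lane L v (suc d)) <ᵇ length (lane L v d)) dprev
  in processRest (appendLane L v (suc dk) (v ≡ᵇ m)) (suc v) r dk m

processSub : Lanes → LowerSub → Lanes
processSub L (a , m) =
  let d1 = largestNonempty (L a)
  in processRest (appendLane L a (suc d1) (a ≡ᵇ m)) (suc a) (m ∸ a) d1 m

lanesOf : List LowerSub → Lanes
lanesOf α = foldl processSub emptyLanes α

EndsAtRightEnd : Lane → Set
EndsAtRightEnd ln = last ln ≡ just true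

IsPlateau : ℕ → List LowerSub → Set
IsPlateau m α =
  -- (i)
  (∀ i → 1 ≤ i → ¬ (lane L m i ≡ []) →
     length (lane L (m ∸ 1) i) ≡ length (lane L m i) ∸ 1)
  -- (ii)
  × (∀ d → 1 ≤ d → ¬ EndsAtRightEnd (lane L (m ∸ 1) d))
  -- (iii)
  × (∀ k → 1 ≤ k → k < m ∸ 1 → ∀ d → 1 ≤ d → ¬ EndsAtRightEnd (lane L k d))
  where
  L = lanesOf α

-- Each lower subinterval with head v opens a new v-lane and no lane is ever emptied, so a
-- sequence has at most as many heads j as nonempty j-lanes. In an l-plateau every right
-- endpoint is at least l: the last lower subinterval reaches least far, and it leaves a lane
-- ending at its right endpoint, which conditions (ii) and (iii) forbid below l. Below the
-- right endpoints the lane algorithm keeps the nonempty v-lanes at positions where the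
-- (v + 1)-lanes are nonempty, so the number of nonempty lanes grows from j up to l.
-- Finally condition (i) makes each l-lane one entry longer than the (l - 1)-lane beside it,
-- while the surplus of entries l over entries l - 1 is the number of heads l. Hence α has
-- exactly as many nonempty l-lanes as heads l, and since the inequality holds separately for
-- α[i] and the remaining lower subintervals, the equality forces it to be tight on α[i].
module Submission where

open import Defs
open import Data.Nat using (ℕ; zero; suc; _+_; _∸_; _≤_; _<_; z≤n; s≤s; _≟_; _≤?_; _<ᵇ_; _≡ᵇ_)
open import Data.Nat.Properties
open import Data.Bool using (Bool; true; false; T)
open import Data.Bool.Properties using (T-≡)
open import Data.Nat.ListAction using (sum)
open import Data.List using (List; []; _∷_; _++_; _∷ʳ_; [_]; length; map; filter; take; drop; last; foldl; initLast; _∷ʳ′_)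
open import Data.List.Properties using (length-++; filter-accept; filter-reject; filter-++; take++drop≡id; foldl-++; foldl-∷ʳ)
open import Data.Product using (∃; _×_; _,_; proj₂)
open import Data.Sum using (_⊎_; inj₁; inj₂)
open import Data.Maybe using (just)
open import Data.List.Relation.Unary.All using (All; []; _∷_)
import Data.List.Relation.Unary.All as All
open import Data.List.Relation.Unary.All.Properties using (take⁺; ∷ʳ⁻)
open import Data.List.Relation.Unary.Linked using (Linked; _∷_)
open import Data.Empty using (⊥-elim)
open import Data.Unit using (tt)
open import Function using (_∘_; Equivalence)
open import Relation.Nullary using (¬_; yes; no)
open import Relation.Binary using (tri<; tri≈; tri>)
open import Relation.Binary.PropositionalEquality hiding ([_])

Nonempty : Lane → Set
Nonempty ln = T (isNonempty ln)

nonempty? : (ln : Lane) → Nonempty ln ⊎ ln ≡ []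
nonempty? []      = inj₂ refl
nonempty? (_ ∷ _) = inj₁ tt

length>0⇒nonempty : (ln : Lane) → 0 < length ln → Nonempty ln
length>0⇒nonempty (_ ∷ _) _ = tt

occupied : List Lane → ℕ
occupied []              = 0
occupied ([] ∷ ls)       = occupied ls
occupied ((_ ∷ _) ∷ ls) = suc (occupied ls)

entries : List Lane → ℕ
entries ls = sum (map length ls)

infix 4 _⊑_

_⊑_ : List Lane → List Lane → Set
xs ⊑ ys = ∀ p → Nonempty (nth xs p) → Nonempty (nth ys p)

⊑⇒occupied≤ : ∀ xs ys → xs ⊑ ys → occupied xs ≤ occupied ys
⊑⇒occupied≤ []              ys              _ = z≤n
⊑⇒occupied≤ ([] ∷ xs)       []              h = ⊑⇒occupied≤ xs [] (h ∘ suc)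
⊑⇒occupied≤ ((_ ∷ _) ∷ xs)  []              h = ⊥-elim (h 0 tt)
⊑⇒occupied≤ ([] ∷ xs)       ([] ∷ ys)       h = ⊑⇒occupied≤ xs ys (h ∘ suc)
⊑⇒occupied≤ ([] ∷ xs)       ((_ ∷ _) ∷ ys)  h = m≤n⇒m≤1+n (⊑⇒occupied≤ xs ys (h ∘ suc))
⊑⇒occupied≤ ((_ ∷ _) ∷ xs)  ([] ∷ ys)       h = ⊥-elim (h 0 tt)
⊑⇒occupied≤ ((_ ∷ _) ∷ xs)  ((_ ∷ _) ∷ ys)  h = s≤s (⊑⇒occupied≤ xs ys (h ∘ suc))

entries≡0 : ∀ ls → (∀ p → length (nth ls p) ≡ 0) → entries ls ≡ 0
entries≡0 []        _ = refl
entries≡0 (ln ∷ ls) h = cong₂ _+_ (h 0) (entries≡0 ls (h ∘ suc))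

-- By truncated subtraction the hypothesis also makes ν empty wherever μ is.
one-shorter⇒entries+occupied≡entries : ∀ ν μ →
  (∀ p → length (nth ν p) ≡ length (nth μ p) ∸ 1) → entries ν + occupied μ ≡ entries μ
one-shorter⇒entries+occupied≡entries ν [] h = trans (+-identityʳ _) (entries≡0 ν h)
one-shorter⇒entries+occupied≡entries [] ([] ∷ μ) h =
  one-shorter⇒entries+occupied≡entries [] μ (h ∘ suc)
one-shorter⇒entries+occupied≡entries [] ((_ ∷ cs) ∷ μ) h rewrite sym (h 0) =
  cong suc (one-shorter⇒entries+occupied≡entries [] μ (h ∘ suc))
one-shorter⇒entries+occupied≡entries (x ∷ ν) ([] ∷ μ) h rewrite h 0 =
  one-shorter⇒entries+occupied≡entries ν μ (h ∘ suc)
one-shorter⇒entries+occupied≡entries (x ∷ ν) ((_ ∷ cs) ∷ μ) h rewrite h 0 = begin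
  length cs + entries ν + suc (occupied μ)  ≡⟨ +-suc (length cs + entries ν) (occupied μ) ⟩
  suc (length cs + entries ν + occupied μ)  ≡⟨ cong suc (+-assoc (length cs) (entries ν) (occupied μ)) ⟩
  suc (length cs + (entries ν + occupied μ)) ≡⟨ cong (λ t → suc (length cs + t)) (one-shorter⇒entries+occupied≡entries ν μ (h ∘ suc)) ⟩
  suc (length cs + entries μ)               ∎
  where open ≡-Reasoning

nth-appendAt-≡ : ∀ xs p b → nth (appendAt xs p b) p ≡ nth xs p ++ [ b ]
nth-appendAt-≡ []       zero    b = refl
nth-appendAt-≡ []       (suc p) b = nth-appendAt-≡ [] p b
nth-appendAt-≡ (x ∷ xs) zero    b = refl
nth-appendAt-≡ (x ∷ xs) (suc p) b = nth-appendAt-≡ xs p b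

nth-appendAt-≢ : ∀ xs p b q → q ≢ p → nth (appendAt xs p b) q ≡ nth xs q
nth-appendAt-≢ []       zero    b zero    q≢p = ⊥-elim (q≢p refl)
nth-appendAt-≢ []       zero    b (suc q) q≢p = refl
nth-appendAt-≢ []       (suc p) b zero    q≢p = refl
nth-appendAt-≢ []       (suc p) b (suc q) q≢p = nth-appendAt-≢ [] p b q (q≢p ∘ cong suc)
nth-appendAt-≢ (x ∷ xs) zero    b zero    q≢p = ⊥-elim (q≢p refl)
nth-appendAt-≢ (x ∷ xs) zero    b (suc q) q≢p = refl
nth-appendAt-≢ (x ∷ xs) (suc p) b zero    q≢p = refl
nth-appendAt-≢ (x ∷ xs) (suc p) b (suc q) q≢p = nth-appendAt-≢ xs p b q (q≢p ∘ cong suc)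

appendAt-nonempty : ∀ xs p b → Nonempty (nth (appendAt xs p b) p)
appendAt-nonempty xs p b rewrite nth-appendAt-≡ xs p b with nth xs p
... | []    = tt
... | _ ∷ _ = tt

appendAt-preserves-nonempty : ∀ xs p b q → Nonempty (nth xs q) → Nonempty (nth (appendAt xs p b) q)
appendAt-preserves-nonempty xs p b q ne with q ≟ p
... | yes refl = appendAt-nonempty xs q b
... | no q≢p   = subst Nonempty (sym (nth-appendAt-≢ xs p b q q≢p)) ne

occupied-appendAt : ∀ xs p b → occupied xs ≤ occupied (appendAt xs p b)
occupied-appendAt []              zero    b = z≤n
occupied-appendAt []              (suc p) b = z≤n
occupied-appendAt ([] ∷ xs)       zero    b = n≤1+n (occupied xs)
occupied-appendAt ((_ ∷ _) ∷ xs)  zero    b = ≤-refl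
occupied-appendAt ([] ∷ xs)       (suc p) b = occupied-appendAt xs p b
occupied-appendAt ((_ ∷ _) ∷ xs)  (suc p) b = s≤s (occupied-appendAt xs p b)

occupied-appendAt-empty : ∀ xs p b → nth xs p ≡ [] → suc (occupied xs) ≤ occupied (appendAt xs p b)
occupied-appendAt-empty []              zero    b _  = ≤-refl
occupied-appendAt-empty []              (suc p) b _  = occupied-appendAt-empty [] p b refl
occupied-appendAt-empty ([] ∷ xs)       zero    b _  = ≤-refl
occupied-appendAt-empty ((_ ∷ _) ∷ xs)  zero    b ()
occupied-appendAt-empty ([] ∷ xs)       (suc p) b e  = occupied-appendAt-empty xs p b e
occupied-appendAt-empty ((_ ∷ _) ∷ xs)  (suc p) b e  = s≤s (occupied-appendAt-empty xs p b e)

entries-appendAt : ∀ xs p b → entries (appendAt xs p b) ≡ suc (entries xs)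
entries-appendAt []       zero    b = refl
entries-appendAt []       (suc p) b = entries-appendAt [] p b
entries-appendAt (x ∷ xs) zero    b =
  cong (_+ entries xs) (trans (length-++ x) (+-comm (length x) 1))
entries-appendAt (x ∷ xs) (suc p) b =
  trans (cong (length x +_) (entries-appendAt xs p b)) (+-suc (length x) (entries xs))

last-snoc-true : ∀ (ln : Lane) → last (ln ++ [ true ]) ≡ just true
last-snoc-true []           = refl
last-snoc-true (_ ∷ [])     = refl
last-snoc-true (_ ∷ y ∷ ln) = last-snoc-true (y ∷ ln)

NonemptyOrZero : List Lane → ℕ → Set
NonemptyOrZero xs d = d ≡ 0 ⊎ ∃ λ e → d ≡ suc e × Nonempty (nth xs e)

searchDown-found : ∀ p d → searchDown p d ≡ 0 ⊎ ∃ λ e → searchDown p d ≡ suc e × p (suc e) ≡ true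
searchDown-found p zero = inj₁ refl
searchDown-found p (suc d) with p (suc d) in eq
... | true  = inj₂ (d , refl , eq)
... | false = searchDown-found p d

searchDown-top : ∀ p d → p (suc d) ≡ true → searchDown p (suc d) ≡ suc d
searchDown-top p d h rewrite h = refl

-- Definitionally the predicate that processRest searches with.
shorterNext : Lanes → ℕ → ℕ → Bool
shorterNext L v d = length (lane L v (suc d)) <ᵇ length (lane L v d)

searchDown-shorterNext : ∀ L v d → NonemptyOrZero (L v) (searchDown (shorterNext L v) d)
searchDown-shorterNext L v d with searchDown-found (shorterNext L v) d
... | inj₁ e            = inj₁ e
... | inj₂ (e , eq , h) =
  inj₂ (e , eq , length>0⇒nonempty (nth (L v) e) (≤-<-trans z≤n (<ᵇ⇒< _ _ (Equivalence.from T-≡ h))))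

shorterNext-at-edge : ∀ ys e → nth ys (suc e) ≡ [] → Nonempty (nth ys e) →
  (length (nth ys (suc e)) <ᵇ length (nth ys e)) ≡ true
shorterNext-at-edge ys e eq ne rewrite eq with nth ys e
... | _ ∷ _ = refl

-- The step that keeps the lanes of v inside those of v + 1: if the entry v went to a new
-- lane L_{d+1}(v), then L_d(v + 1) is nonempty and L_{d+1}(v + 1) empty, so the search
-- for the entry v + 1 stops at d.
appendAt-searchDown-⊑ : ∀ xs ys d b b' (p : ℕ → Bool) → xs ⊑ ys → NonemptyOrZero xs d →
  (∀ e → nth ys (suc e) ≡ [] → Nonempty (nth ys e) → p (suc e) ≡ true) →
  appendAt xs d b ⊑ appendAt ys (searchDown p d) b'
appendAt-searchDown-⊑ xs ys d b b' p xs⊑ys d-ok edge q ne with q ≟ d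
... | no q≢d   = appendAt-preserves-nonempty ys _ b' q
                   (xs⊑ys q (subst Nonempty (nth-appendAt-≢ xs d b q q≢d) ne))
... | yes refl with nonempty? (nth ys q)
...   | inj₁ ne-q = appendAt-preserves-nonempty ys _ b' q ne-q
...   | inj₂ empty with d-ok
...     | inj₁ refl               = appendAt-nonempty ys 0 b'
...     | inj₂ (e , refl , ne-e) rewrite searchDown-top p e (edge e empty (xs⊑ys e ne-e)) =
  appendAt-nonempty ys (suc e) b'

largestNonemptyFrom-≥ : ∀ best xs d → best ≤ d → best ≤ largestNonemptyFrom best xs d
largestNonemptyFrom-≥ best []              d le = ≤-refl
largestNonemptyFrom-≥ best ([] ∷ xs)       d le = largestNonemptyFrom-≥ best xs (suc d) (m≤n⇒m≤1+n le)
largestNonemptyFrom-≥ best ((_ ∷ _) ∷ xs)  d le = ≤-trans le (largestNonemptyFrom-≥ d xs (suc d) (n≤1+n d))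

largestNonemptyFrom-beyond : ∀ best xs d → best ≤ d → ∀ k →
  largestNonemptyFrom best xs d < d + k → nth xs k ≡ []
largestNonemptyFrom-beyond best [] d le k lt = refl
largestNonemptyFrom-beyond best ([] ∷ xs) d le zero lt = refl
largestNonemptyFrom-beyond best ((_ ∷ _) ∷ xs) d le zero lt =
  ⊥-elim (<-irrefl refl (≤-<-trans (largestNonemptyFrom-≥ d xs (suc d) (n≤1+n d))
                                    (subst (largestNonemptyFrom d xs (suc d) <_) (+-identityʳ d) lt)))
largestNonemptyFrom-beyond best ([] ∷ xs) d le (suc k) lt =
  largestNonemptyFrom-beyond best xs (suc d) (m≤n⇒m≤1+n le) k
    (subst (largestNonemptyFrom best xs (suc d) <_) (+-suc d k) lt)
largestNonemptyFrom-beyond best ((_ ∷ _) ∷ xs) d le (suc k) lt =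
  largestNonemptyFrom-beyond d xs (suc d) (n≤1+n d) k
    (subst (largestNonemptyFrom d xs (suc d) <_) (+-suc d k) lt)

largestNonemptyFrom-found : ∀ best xs d → largestNonemptyFrom best xs d ≡ best ⊎
  ∃ λ k → largestNonemptyFrom best xs d ≡ d + k × Nonempty (nth xs k)
largestNonemptyFrom-found best [] d = inj₁ refl
largestNonemptyFrom-found best ([] ∷ xs) d with largestNonemptyFrom-found best xs (suc d)
... | inj₁ e            = inj₁ e
... | inj₂ (k , e , ne) = inj₂ (suc k , trans e (sym (+-suc d k)) , ne)
largestNonemptyFrom-found best ((_ ∷ _) ∷ xs) d with largestNonemptyFrom-found d xs (suc d)
... | inj₁ e            = inj₂ (0 , trans e (sym (+-identityʳ d)) , tt)
... | inj₂ (k , e , ne) = inj₂ (suc k , trans e (sym (+-suc d k)) , ne)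

largestNonempty-nonemptyOrZero : ∀ xs → NonemptyOrZero xs (largestNonempty xs)
largestNonempty-nonemptyOrZero xs with largestNonemptyFrom-found 0 xs 1
... | inj₁ e  = inj₁ e
... | inj₂ kn = inj₂ kn

nth-largestNonempty : ∀ xs → nth xs (largestNonempty xs) ≡ []
nth-largestNonempty xs = largestNonemptyFrom-beyond 0 xs 1 z≤n (largestNonempty xs) (n<1+n _)

Nested : Lanes → ℕ → Set
Nested L w = L w ⊑ L (suc w)

appendLane-≡ : ∀ L v p b → appendLane L v (suc p) b v ≡ appendAt (L v) p b
appendLane-≡ L v p b with v ≟ v
... | yes _  = refl
... | no v≢v = ⊥-elim (v≢v refl)

appendLane-≢ : ∀ L v d b w → w ≢ v → appendLane L v d b w ≡ L w
appendLane-≢ L v d b w w≢v with w ≟ v | d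
... | yes w≡v | _     = ⊥-elim (w≢v w≡v)
... | no _    | zero  = refl
... | no _    | suc _ = refl

occupied-appendLane : ∀ L v d b w → occupied (L w) ≤ occupied (appendLane L v d b w)
occupied-appendLane L v d b w with w ≟ v | d
... | yes _ | zero  = ≤-refl
... | yes _ | suc p = occupied-appendAt (L w) p b
... | no _  | _     = ≤-refl

appendLane-nested : ∀ L v d b w → v < w → Nested L w → Nested (appendLane L v d b) w
appendLane-nested L v d b w v<w =
  subst₂ _⊑_ (sym (appendLane-≢ L v d b w (≢-sym (<⇒≢ v<w))))
             (sym (appendLane-≢ L v d b (suc w) (≢-sym (<⇒≢ (m<n⇒m<1+n v<w)))))

processRest-below : ∀ r L v d m w → w < v → processRest L v r d m w ≡ L w
processRest-below zero    L v d m w lt = refl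
processRest-below (suc r) L v d m w lt =
  trans (processRest-below r _ (suc v) _ m w (m<n⇒m<1+n lt)) (appendLane-≢ L v _ _ w (<⇒≢ lt))

occupied-processRest : ∀ r L v d m w → occupied (L w) ≤ occupied (processRest L v r d m w)
occupied-processRest zero    L v d m w = ≤-refl
occupied-processRest (suc r) L v d m w =
  ≤-trans (occupied-appendLane L v _ _ w) (occupied-processRest r _ (suc v) _ m w)

entries-processRest : ∀ r L v d m w → v ≤ w → w < v + r →
  entries (processRest L v r d m w) ≡ suc (entries (L w))
entries-processRest zero L v d m w v≤w w<v+0 =
  ⊥-elim (<⇒≱ w<v+0 (subst (_≤ w) (sym (+-identityʳ v)) v≤w))
entries-processRest (suc r) L v d m w v≤w w<v+r+1 with w ≟ v
... | yes refl = begin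
  entries (processRest L₁ (suc w) r _ m w)  ≡⟨ cong entries (processRest-below r _ (suc w) _ m w (n<1+n w)) ⟩
  entries (L₁ w)                           ≡⟨ cong entries (appendLane-≡ L w _ _) ⟩
  entries (appendAt (L w) _ _)             ≡⟨ entries-appendAt (L w) _ _ ⟩
  suc (entries (L w))                      ∎
  where
  open ≡-Reasoning
  L₁ = appendLane L w _ (w ≡ᵇ m)
... | no w≢v =
  trans (entries-processRest r _ (suc v) _ m w (≤∧≢⇒< v≤w (w≢v ∘ sym)) (subst (w <_) (+-suc v r) w<v+r+1))
        (cong (suc ∘ entries) (appendLane-≢ L v _ _ w w≢v))

≡ᵇ-refl : ∀ m → (m ≡ᵇ m) ≡ true
≡ᵇ-refl m = Equivalence.to T-≡ (≡⇒≡ᵇ m m refl)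

appendAt-endsAtRightEnd : ∀ xs p m → EndsAtRightEnd (nth (appendAt xs p (m ≡ᵇ m)) p)
appendAt-endsAtRightEnd xs p m rewrite nth-appendAt-≡ xs p (m ≡ᵇ m) | ≡ᵇ-refl m =
  last-snoc-true (nth xs p)

processRest-endsAtRightEnd : ∀ r L v d m → v ≤ m → m < v + r →
  ∃ λ p → EndsAtRightEnd (nth (processRest L v r d m m) p)
processRest-endsAtRightEnd zero L v d m v≤m m<v+0 =
  ⊥-elim (<⇒≱ m<v+0 (subst (_≤ m) (sym (+-identityʳ v)) v≤m))
processRest-endsAtRightEnd (suc r) L v d m v≤m m<v+r+1 with m ≟ v
... | yes refl = dₖ ,
  subst (λ ls → EndsAtRightEnd (nth ls dₖ))
        (sym (trans (processRest-below r L₁ (suc m) dₖ m m (n<1+n m)) (appendLane-≡ L m dₖ _)))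
        (appendAt-endsAtRightEnd (L m) dₖ m)
  where
  dₖ = searchDown (shorterNext L m) d
  L₁ = appendLane L m (suc dₖ) (m ≡ᵇ m)
... | no m≢v = processRest-endsAtRightEnd r _ (suc v) _ m (≤∧≢⇒< v≤m (m≢v ∘ sym)) (subst (m <_) (+-suc v r) m<v+r+1)

-- X is the list of u-lanes before the entry u of the current subinterval was appended at d.
processRest-nested : ∀ r L u d m X b B → B ≤ u + r →
  L u ≡ appendAt X d b → X ⊑ L (suc u) → NonemptyOrZero X d →
  (∀ w → u < w → w < B → Nested L w) →
  ∀ w → u ≤ w → w < B → Nested (processRest L (suc u) r d m) w
processRest-nested zero L u d m X b B B≤u+0 _ _ _ _ w u≤w w<B =
  ⊥-elim (<⇒≱ (<-≤-trans w<B B≤u+0) (subst (_≤ w) (sym (+-identityʳ u)) u≤w))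
processRest-nested (suc r) L u d m X b B B≤u+r+1 Lu≡ X⊑ d-ok nested w u≤w w<B with u ≟ w
... | yes refl = subst₂ _⊑_ (sym Lw) (sym Lw+1)
  (appendAt-searchDown-⊑ X (L (suc u)) d b _ (shorterNext L (suc u)) X⊑ d-ok
     (shorterNext-at-edge (L (suc u))))
  where
  dₖ = searchDown (shorterNext L (suc u)) d
  L₁ = appendLane L (suc u) (suc dₖ) (suc u ≡ᵇ m)
  Lw : processRest L₁ (suc (suc u)) r dₖ m u ≡ appendAt X d b
  Lw = trans (processRest-below r L₁ (suc (suc u)) dₖ m u (m<n⇒m<1+n (n<1+n u)))
             (trans (appendLane-≢ L (suc u) _ _ u (<⇒≢ (n<1+n u))) Lu≡)
  Lw+1 : processRest L₁ (suc (suc u)) r dₖ m (suc u) ≡ appendAt (L (suc u)) dₖ (suc u ≡ᵇ m)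
  Lw+1 = trans (processRest-below r L₁ (suc (suc u)) dₖ m (suc u) (n<1+n (suc u))) (appendLane-≡ L (suc u) dₖ _)
... | no u≢w =
  processRest-nested r L₁ (suc u) dₖ m (L (suc u)) (suc u ≡ᵇ m) B (subst (B ≤_) (+-suc u r) B≤u+r+1)
    (appendLane-≡ L (suc u) dₖ _)
    (subst (L (suc u) ⊑_) (sym (appendLane-≢ L (suc u) _ _ (suc (suc u)) (≢-sym (<⇒≢ (n<1+n (suc u))))))
       (nested (suc u) ≤-refl (≤-<-trans u<w w<B)))
    (searchDown-shorterNext L (suc u) d)
    (λ w' u+1<w' w'<B → appendLane-nested L (suc u) _ _ w' u+1<w' (nested w' (<⇒≤ u+1<w') w'<B))
    w u<w w<B
  where
  dₖ = searchDown (shorterNext L (suc u)) d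
  L₁ = appendLane L (suc u) (suc dₖ) (suc u ≡ᵇ m)
  u<w : u < w
  u<w = ≤∧≢⇒< u≤w u≢w

processSub-below : ∀ L a m w → w < a → processSub L (a , m) w ≡ L w
processSub-below L a m w w<a =
  trans (processRest-below (m ∸ a) _ (suc a) _ m w (m<n⇒m<1+n w<a)) (appendLane-≢ L a _ _ w (<⇒≢ w<a))

processSub-head : ∀ L a m → processSub L (a , m) a ≡ appendAt (L a) (largestNonempty (L a)) (a ≡ᵇ m)
processSub-head L a m = trans (processRest-below (m ∸ a) _ (suc a) _ m a (n<1+n a)) (appendLane-≡ L a _ _)

occupied-processSub : ∀ L I w → occupied (L w) ≤ occupied (processSub L I w)
occupied-processSub L (a , m) w =
  ≤-trans (occupied-appendLane L a _ _ w) (occupied-processRest (m ∸ a) _ (suc a) _ m w)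

occupied-processSub-head : ∀ L a m → suc (occupied (L a)) ≤ occupied (processSub L (a , m) a)
occupied-processSub-head L a m rewrite processSub-head L a m =
  occupied-appendAt-empty (L a) _ _ (nth-largestNonempty (L a))

entries-processSub : ∀ L a m w → a ≤ w → w ≤ m → entries (processSub L (a , m) w) ≡ suc (entries (L w))
entries-processSub L a m w a≤w w≤m with w ≟ a
... | yes refl = trans (cong entries (processSub-head L w m)) (entries-appendAt (L w) _ _)
... | no w≢a   =
  trans (entries-processRest (m ∸ a) _ (suc a) _ m w (≤∧≢⇒< a≤w (w≢a ∘ sym))
           (s≤s (subst (w ≤_) (sym (m+[n∸m]≡n (≤-trans a≤w w≤m))) w≤m)))
        (cong (suc ∘ entries) (appendLane-≢ L a _ _ w w≢a))

processSub-endsAtRightEnd : ∀ L a m → a ≤ m → ∃ λ p → EndsAtRightEnd (nth (processSub L (a , m) m) p)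
processSub-endsAtRightEnd L a m a≤m with m ≟ a
... | yes refl = largestNonempty (L m) ,
  subst (λ ls → EndsAtRightEnd (nth ls (largestNonempty (L m)))) (sym (processSub-head L m m))
        (appendAt-endsAtRightEnd (L m) _ m)
... | no m≢a = processRest-endsAtRightEnd (m ∸ a) _ (suc a) _ m (≤∧≢⇒< a≤m (m≢a ∘ sym))
                 (s≤s (≤-reflexive (sym (m+[n∸m]≡n a≤m))))

processSub-nested : ∀ L a m B → B ≤ m → (∀ w → w < B → Nested L w) →
  ∀ w → w < B → Nested (processSub L (a , m)) w
processSub-nested L a m B B≤m nested w w<B with <-cmp (suc w) a
... | tri< w+1<a _ _ =
  subst₂ _⊑_ (sym (processSub-below L a m w (<-trans (n<1+n w) w+1<a)))
             (sym (processSub-below L a m (suc w) w+1<a)) (nested w w<B)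
... | tri≈ _ refl _ =
  subst₂ _⊑_ (sym (processSub-below L (suc w) m w (n<1+n w))) (sym (processSub-head L (suc w) m))
    (λ q ne → appendAt-preserves-nonempty (L (suc w)) _ _ q (nested w w<B q ne))
... | tri> _ _ a<w+1 =
  processRest-nested (m ∸ a) L₁ a d₁ m (L a) (a ≡ᵇ m) B
    (subst (B ≤_) (sym (m+[n∸m]≡n a≤m)) B≤m)
    (appendLane-≡ L a d₁ _)
    (subst (L a ⊑_) (sym (appendLane-≢ L a _ _ (suc a) (≢-sym (<⇒≢ (n<1+n a))))) (nested a (≤-<-trans a≤w w<B)))
    (largestNonempty-nonemptyOrZero (L a))
    (λ w' a<w' w'<B → appendLane-nested L a _ _ w' a<w' (nested w' w'<B))
    w a≤w w<B
  where
  d₁ = largestNonempty (L a)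
  L₁ = appendLane L a (suc d₁) (a ≡ᵇ m)
  a≤w : a ≤ w
  a≤w = ≤-pred a<w+1
  a≤m : a ≤ m
  a≤m = ≤-trans a≤w (≤-trans (<⇒≤ w<B) B≤m)

countHead-single-≡ : ∀ a m → countHead a [ (a , m) ] ≡ 1
countHead-single-≡ a m = cong length (filter-accept (λ I → head I ≟ a) {x = a , m} {xs = []} refl)

countHead-single-≢ : ∀ a m v → a ≢ v → countHead v [ (a , m) ] ≡ 0
countHead-single-≢ a m v a≢v = cong length (filter-reject (λ I → head I ≟ v) {x = a , m} {xs = []} a≢v)

countHead-++ : ∀ h xs ys → countHead h (xs ++ ys) ≡ countHead h xs + countHead h ys
countHead-++ h xs ys = trans (cong length (filter-++ (λ I → head I ≟ h) xs ys)) (length-++ (filter _ xs))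

occupied-processSub-countHead : ∀ S a m v →
  occupied (S v) + countHead v [ (a , m) ] ≤ occupied (processSub S (a , m) v)
occupied-processSub-countHead S a m v with a ≟ v
... | yes refl rewrite countHead-single-≡ a m | +-comm (occupied (S a)) 1 = occupied-processSub-head S a m
... | no a≢v   rewrite countHead-single-≢ a m v a≢v | +-identityʳ (occupied (S v)) =
  occupied-processSub S (a , m) v

occupied-foldl : ∀ xs S v → occupied (S v) + countHead v xs ≤ occupied (foldl processSub S xs v)
occupied-foldl []      S v = ≤-reflexive (+-identityʳ _)
occupied-foldl (I@(a , m) ∷ xs) S v = begin
  occupied (S v) + countHead v (I ∷ xs)                    ≡⟨ cong (occupied (S v) +_) (countHead-++ v [ I ] xs) ⟩
  occupied (S v) + (countHead v [ I ] + countHead v xs)    ≡⟨ +-assoc (occupied (S v)) _ _ ⟨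
  occupied (S v) + countHead v [ I ] + countHead v xs      ≤⟨ +-monoˡ-≤ (countHead v xs) (occupied-processSub-countHead S a m v) ⟩
  occupied (processSub S I v) + countHead v xs             ≤⟨ occupied-foldl xs (processSub S I) v ⟩
  occupied (foldl processSub S (I ∷ xs) v)                 ∎
  where open ≤-Reasoning

countHead≤occupied : ∀ xs v → countHead v xs ≤ occupied (lanesOf xs v)
countHead≤occupied xs v = occupied-foldl xs emptyLanes v

occupied-prefix : ∀ α i v → occupied (lanesOf α v) ≡ countHead v α →
  occupied (lanesOf (take i α) v) ≤ countHead v (take i α)
occupied-prefix α i v tight = +-cancelʳ-≤ (countHead v rest) _ _ (begin
  occupied (lanesOf (take i α) v) + countHead v rest       ≤⟨ occupied-foldl rest (lanesOf (take i α)) v ⟩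
  occupied (foldl processSub (lanesOf (take i α)) rest v)  ≡⟨ cong (λ L → occupied (L v)) (foldl-++ processSub emptyLanes (take i α) rest) ⟨
  occupied (lanesOf (take i α ++ rest) v)                  ≡⟨ cong (λ β → occupied (lanesOf β v)) (take++drop≡id i α) ⟩
  occupied (lanesOf α v)                                   ≡⟨ tight ⟩
  countHead v α                                            ≡⟨ cong (countHead v) (take++drop≡id i α) ⟨
  countHead v (take i α ++ rest)                           ≡⟨ countHead-++ v (take i α) rest ⟩
  countHead v (take i α) + countHead v rest                ∎)
  where
  open ≤-Reasoning
  rest = drop i α

foldl-nested : ∀ xs S B → All (λ I → B ≤ rightEnd I) xs → (∀ w → w < B → Nested S w) →
  ∀ w → w < B → Nested (foldl processSub S xs) w
foldl-nested []             S B _           nested = nested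
foldl-nested ((a , m) ∷ xs) S B (B≤m ∷ B≤) nested =
  foldl-nested xs (processSub S (a , m)) B B≤ (processSub-nested S a m B B≤m nested)

lanesOf-nested : ∀ xs B → All (λ I → B ≤ rightEnd I) xs → ∀ w → w < B → Nested (lanesOf xs) w
lanesOf-nested xs B B≤ = foldl-nested xs emptyLanes B B≤ (λ _ _ _ ())

occupied-mono : ∀ (L : Lanes) B → (∀ w → w < B → Nested L w) → ∀ j → j ≤ B → occupied (L j) ≤ occupied (L B)
occupied-mono L zero    _      .zero z≤n = ≤-refl
occupied-mono L (suc B) nested j     j≤B with j ≟ suc B
... | yes refl = ≤-refl
... | no j≢B+1 =
  ≤-trans (occupied-mono L B (λ w w<B → nested w (m<n⇒m<1+n w<B)) j (≤-pred (≤∧≢⇒< j≤B j≢B+1)))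
          (⊑⇒occupied≤ (L B) (L (suc B)) (nested B (n<1+n B)))

-- A lower subinterval reaching k + 1 contains k as well unless its head is k + 1.
entries-gap-processSub : ∀ S a m k c → suc k ≤ m → entries (S (suc k)) ≡ entries (S k) + c →
  entries (processSub S (a , m) (suc k)) ≡ entries (processSub S (a , m) k) + (c + countHead (suc k) [ (a , m) ])
entries-gap-processSub S a m k c k<m gap with a ≟ suc k
... | yes refl rewrite countHead-single-≡ a m = begin
  entries (processSub S (suc k , m) (suc k))  ≡⟨ entries-processSub S (suc k) m (suc k) ≤-refl k<m ⟩
  suc (entries (S (suc k)))                   ≡⟨ cong suc gap ⟩
  suc (entries (S k) + c)                     ≡⟨ +-suc (entries (S k)) c ⟨
  entries (S k) + suc c                       ≡⟨ cong₂ _+_ (cong entries (processSub-below S (suc k) m k (n<1+n k))) (+-comm c 1) ⟨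
  entries (processSub S (suc k , m) k) + (c + 1) ∎
  where open ≡-Reasoning
... | no a≢k+1 rewrite countHead-single-≢ a m (suc k) a≢k+1 | +-identityʳ c with a ≤? k
...   | yes a≤k = begin
  entries (processSub S (a , m) (suc k))  ≡⟨ entries-processSub S a m (suc k) (m≤n⇒m≤1+n a≤k) k<m ⟩
  suc (entries (S (suc k)))               ≡⟨ cong suc gap ⟩
  suc (entries (S k)) + c                 ≡⟨ cong (_+ c) (entries-processSub S a m k a≤k (<⇒≤ k<m)) ⟨
  entries (processSub S (a , m) k) + c    ∎
  where open ≡-Reasoning
...   | no a≰k = begin
  entries (processSub S (a , m) (suc k))  ≡⟨ cong entries (processSub-below S a m (suc k) k+1<a) ⟩
  entries (S (suc k))                     ≡⟨ gap ⟩
  entries (S k) + c                       ≡⟨ cong (λ L → entries L + c) (processSub-below S a m k (<-trans (n<1+n k) k+1<a)) ⟨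
  entries (processSub S (a , m) k) + c    ∎
  where
  open ≡-Reasoning
  k+1<a : suc k < a
  k+1<a = ≤∧≢⇒< (≰⇒> a≰k) (a≢k+1 ∘ sym)

entries-gap-foldl : ∀ xs S k c → All (λ I → suc k ≤ rightEnd I) xs → entries (S (suc k)) ≡ entries (S k) + c →
  entries (foldl processSub S xs (suc k)) ≡ entries (foldl processSub S xs k) + (c + countHead (suc k) xs)
entries-gap-foldl [] S k c _ gap = trans gap (cong (entries (S k) +_) (sym (+-identityʳ c)))
entries-gap-foldl ((a , m) ∷ xs) S k c (k<m ∷ k<) gap =
  trans (entries-gap-foldl xs (processSub S (a , m)) k _ k< (entries-gap-processSub S a m k c k<m gap))
        (cong (entries (foldl processSub S ((a , m) ∷ xs) k) +_)
              (trans (+-assoc c _ _) (cong (c +_) (sym (countHead-++ (suc k) [ (a , m) ] xs)))))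

plateau-no-right-end : ∀ k α → IsPlateau (suc (suc k)) α →
  ∀ v → 1 ≤ v → v ≤ suc k → ∀ d → 1 ≤ d → ¬ EndsAtRightEnd (lane (lanesOf α) v d)
plateau-no-right-end k α (_ , no-end-top , no-end-below) v 1≤v v≤k+1 with v ≟ suc k
... | yes refl  = no-end-top
... | no v≢k+1 = no-end-below v 1≤v (≤∧≢⇒< v≤k+1 v≢k+1)

rightEnd-antitone : ∀ {I J} → CascStep I J → rightEnd J ≤ rightEnd I
rightEnd-antitone (inj₁ m'<m)       = <⇒≤ m'<m
rightEnd-antitone (inj₂ (m'≡m , _)) = ≤-reflexive m'≡m

last-rightEnd-minimal : ∀ xs x → Linked CascStep (xs ∷ʳ x) → All (λ I → rightEnd x ≤ rightEnd I) (xs ∷ʳ x)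
last-rightEnd-minimal []           x _           = ≤-refl ∷ []
last-rightEnd-minimal (y ∷ [])     x (y→x ∷ _)  = rightEnd-antitone y→x ∷ ≤-refl ∷ []
last-rightEnd-minimal (y ∷ z ∷ ys) x (y→z ∷ lk) with last-rightEnd-minimal (z ∷ ys) x lk
... | x≤z ∷ x≤ = ≤-trans x≤z (rightEnd-antitone y→z) ∷ x≤z ∷ x≤

plateau⇒rightEnd≥ : ∀ n k α → IsCascading n α → IsPlateau (suc (suc k)) α →
  All (λ I → suc (suc k) ≤ rightEnd I) α
plateau⇒rightEnd≥ n k α (valid , linked) plateau with initLast α
... | [] = []
... | xs ∷ʳ′ (a , m) with suc (suc k) ≤? m | proj₂ (∷ʳ⁻ valid)
...   | yes l≤m | _ = All.map (≤-trans l≤m) (last-rightEnd-minimal xs (a , m) linked)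
...   | no l≰m  | 1≤a , a≤m , _ with processSub-endsAtRightEnd (lanesOf xs) a m a≤m
...     | p , ends = ⊥-elim (plateau-no-right-end k (xs ∷ʳ (a , m)) plateau m (≤-trans 1≤a a≤m)
                       (≤-pred (≰⇒> l≰m)) (suc p) (s≤s z≤n)
                       (subst (λ L → EndsAtRightEnd (nth (L m) p))
                              (sym (foldl-∷ʳ processSub emptyLanes (a , m) xs)) ends))

occupied-plateau : ∀ k α → All (λ I → suc (suc k) ≤ rightEnd I) α → IsPlateau (suc (suc k)) α →
  occupied (lanesOf α (suc (suc k))) ≡ countHead (suc (suc k)) α
occupied-plateau k α l≤ (one-shorter , _ , _) = +-cancelˡ-≡ (entries (L (suc k))) _ _ (begin
  entries (L (suc k)) + occupied (L l)  ≡⟨ one-shorter⇒entries+occupied≡entries (L (suc k)) (L l) lengths ⟩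
  entries (L l)                         ≡⟨ entries-gap-foldl α emptyLanes (suc k) 0 l≤ refl ⟩
  entries (L (suc k)) + countHead l α   ∎)
  where
  open ≡-Reasoning
  l = suc (suc k)
  L = lanesOf α
  lengths : ∀ p → length (nth (L (suc k)) p) ≡ length (nth (L l) p) ∸ 1
  lengths p with nonempty? (nth (L l) p)
  ... | inj₁ ne = one-shorter (suc p) (s≤s z≤n) (λ e → subst Nonempty e ne)
  ... | inj₂ empty with nonempty? (nth (L (suc k)) p)
  ...   | inj₁ ne     = ⊥-elim (subst Nonempty empty (lanesOf-nested α l l≤ (suc k) (n<1+n _) p ne))
  ...   | inj₂ empty′ rewrite empty | empty′ = refl

mainTheorem12 : (n l : ℕ) → 2 ≤ l → l ≤ n →
    (α : List LowerSub) → IsCascading n α → IsPlateau l α →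
    ∀ i → i ≤ length α → ∀ j → j < l →
    countHead j (prefix i α) ≤ countHead l (prefix i α)
mainTheorem12 n (suc (suc k)) (s≤s (s≤s z≤n)) _ α cascading plateau i _ j j<l = begin
  countHead j αᵢ   ≤⟨ countHead≤occupied αᵢ j ⟩
  occupied (Lᵢ j)  ≤⟨ occupied-mono Lᵢ l (lanesOf-nested αᵢ l (take⁺ i l≤)) j (<⇒≤ j<l) ⟩
  occupied (Lᵢ l)  ≤⟨ occupied-prefix α i l (occupied-plateau k α l≤ plateau) ⟩
  countHead l αᵢ   ∎
  where
  open ≤-Reasoning
  l = suc (suc k)
  αᵢ = take i α
  Lᵢ = lanesOf αᵢ
  l≤ : All (λ I → l ≤ rightEnd I) α
  l≤ = plateau⇒rightEnd≥ n k α cascading plateau
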